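{- Let $C=(X,\xi)$ and $D$ be $T$-coalgebras, let $S$ be a $\Lambda$-simulation of $C$ by $D$, and let $\mathcal V:\Delta\to\mathcal P(X)$ be a valuation of fixpoint variables. Then for every positive $\Lambda$-$\nu$-formula $\phi$, $S[[\![\phi]\!]_{C,\mathcal V}]\subseteq[\![\phi]\!]_{D,S[\mathcal V]}$, where $S[\mathcal V]$ is the valuation sending $y\in\Delta$ to $S[\mathcal V(y)]$.
   Context: Fix an endofunctor $T$ on sets, non-trivial and preserving subsets. $\Lambda$ is a set of modal operators $\heartsuit$ (unary; atomic propositions nullary), each with a monotone natural predicate lifting $[\![\heartsuit]\!]_X:\mathcal P(X)\to\mathcal P(TX)$; write $t\models\heartsuit A$ for $t\in[\![\heartsuit]\!]_X(A)$. A $\Lambda$-simulation of $C=(X,\xi)$ by $D=(Y,\zeta)$ is $S\subseteq X\times Y$ such that $xSy$ and $\xi(x)\models\heartsuit A$ imply $\zeta(y)\models\heartsuit S[A]$ for all $\heartsuit\in\Lambda$, $A\subseteq X$, with $S[A]=\{y:\exists x\in A.\,xSy\}$. Fix a set $\Delta$ of fixpoint variables. Positive $\Lambda$-$\nu$-formulas: $\phi::=\top\mid\bot\mid\phi\wedge\phi\mid\phi\vee\phi\mid\heartsuit\phi\mid y\mid\alpha(y_0;y_1,\dots,y_n).(\phi_0;\phi_1,\dots,\phi_n)$ with $\alpha\in\{\nu,\mu\}$, $y,y_i\in\Delta$, $y_0,\dots,y_n$ distinct. Semantics over $C=(X,\xi)$ and $\mathcal V:\Delta\to\mathcal P(X)$: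 Boolean clauses as usual, $[\![y]\!]_{C,\mathcal V}=\mathcal V(y)$, $[\![\heartsuit\phi]\!]_{C,\mathcal V}=\{x:\xi(x)\models\heartsuit[\![\phi]\!]_{C,\mathcal V}\}$, and $[\![\nu(y_0;\dots,y_n).(\phi_0;\dots,\phi_n)]\!]_{C,\mathcal V}$ is the first component $A_0$ of the greatest fixpoint of the monotone map on $\mathcal P(X)^{n+1}$ sending $(A_0,\dots,A_n)$ to $([\![\phi_i]\!]_{C,\mathcal V[y_0\mapsto A_0,\dots,y_n\mapsto A_n]})_{i=0,\dots,n}$; $\mu$ likewise with the least fixpoint. -}

module Defs where

open import Level using (Level; _⊔_; suc; zero; Lift; Setω)
open import Data.Nat using (ℕ) renaming (suc to sucℕ)
open import Data.Fin using (Fin) renaming (zero to fzero)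
open import Data.Product using (Σ; ∃; _×_; _,_)
open import Data.Sum using (_⊎_)
open import Data.Unit using (⊤)
open import Data.Empty using (⊥)
open import Function using (id; _∘_; _⇔_)
open import Function.Definitions using (Injective)
open import Relation.Binary.PropositionalEquality using (_≡_)
open import Relation.Unary using (Pred; _⊆_)
open import Relation.Binary using (REL)
open import Relation.Nullary using (¬_)

record SetFunctor : Set₁ where
  field
    F      : Set → Set
    fmap   : ∀ {A B : Set} → (A → B) → F A → F B
    fmap-id : ∀ {A : Set} (t : F A) → fmap id t ≡ t
    fmap-∘  : ∀ {A B C : Set} (f : B → C) (g : A → B) (t : F A) →
              fmap (f ∘ g) t ≡ fmap f (fmap g t)

NonTrivial : SetFunctor → Set₁
NonTrivial T = ∀ (X : Set) → X → SetFunctor.F T X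

PreservesSubsets : SetFunctor → Set₁
PreservesSubsets T = ∀ {A B : Set} (f : A → B) →
  Injective _≡_ _≡_ f → Injective _≡_ _≡_ (SetFunctor.fmap T f)

-- Modal similarity type Λ with monotone natural predicate liftings.
-- Λ₀ : nullary operators (atomic propositions), Λ₁ : unary operators.
-- Subsets of X are predicates X → Set a (at any universe level a).

record Signature (T : SetFunctor) : Setω where
  open SetFunctor T
  field
    Λ₀ Λ₁ : Set
    atom     : Λ₀ → ∀ {X : Set} → Pred (F X) zero
    atom-nat : ∀ (p : Λ₀) {X Y : Set} (f : X → Y) (t : F X) →
               atom p (fmap f t) ⇔ atom p t
    lift     : Λ₁ → ∀ {a} {X : Set} → Pred X a → Pred (F X) a
    lift-mono : ∀ (h : Λ₁) {a b} {X : Set} {A : Pred X a} {B : Pred X b} →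
                A ⊆ B → lift h A ⊆ lift h B
    lift-nat : ∀ (h : Λ₁) {a} {X Y : Set} (f : X → Y) (A : Pred Y a) (t : F X) →
               lift h (A ∘ f) t ⇔ lift h A (fmap f t)

record Coalg (T : SetFunctor) : Set₁ where
  field
    Carrier : Set
    str     : Carrier → SetFunctor.F T Carrier

image : ∀ {a ℓ} {X Y : Set} → REL X Y ℓ → Pred X a → Pred Y (a ⊔ ℓ)
image S A y = ∃ λ x → A x × S x y

record IsSimulation {T : SetFunctor} (Σ' : Signature T) (C D : Coalg T)
    {ℓ} (S : REL (Coalg.Carrier C) (Coalg.Carrier D) ℓ) : Setω where
  open Signature Σ'
  open Coalg
  field
    sim-atom : ∀ (p : Λ₀) {x y} → S x y →
               atom p (str C x) → atom p (str D y)
    sim-lift : ∀ (h : Λ₁) {a} (A : Pred (Carrier C) a) {x y} → S x y →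
               lift h A (str C x) → lift h (image S A) (str D y)

data FixKind : Set where
  ν μ : FixKind

data Form (Λ₀ Λ₁ Δ : Set) : Set where
  tt ff : Form Λ₀ Λ₁ Δ
  _∧'_ _∨'_ : Form Λ₀ Λ₁ Δ → Form Λ₀ Λ₁ Δ → Form Λ₀ Λ₁ Δ
  prop : Λ₀ → Form Λ₀ Λ₁ Δ
  mod  : Λ₁ → Form Λ₀ Λ₁ Δ → Form Λ₀ Λ₁ Δ
  var  : Δ → Form Λ₀ Λ₁ Δ
  -- α(y₀;y₁,…,yₙ).(φ₀;φ₁,…,φₙ), with y₀,…,yₙ distinct
  fix  : FixKind → (n : ℕ) (ys : Fin (sucℕ n) → Δ) →
         Injective _≡_ _≡_ ys →
         (φs : Fin (sucℕ n) → Form Λ₀ Λ₁ Δ) → Form Λ₀ Λ₁ Δ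

Val : ∀ {Δ : Set} (X : Set) ℓ → Set (suc ℓ)
Val {Δ} X ℓ = Δ → Pred X ℓ

update : ∀ {ℓ} {Δ X : Set} {n : ℕ} → (Δ → Pred X ℓ) →
         (Fin (sucℕ n) → Δ) → (Fin (sucℕ n) → Pred X ℓ) → Δ → Pred X ℓ
update V ys As z x =
  (∃ λ i → z ≡ ys i × As i x) ⊎ ((∀ i → ¬ (z ≡ ys i)) × V z x)

imageVal : ∀ {ℓ} {Δ X Y : Set} → REL X Y ℓ → (Δ → Pred X ℓ) → Δ → Pred Y ℓ
imageVal S V z = image S (V z)

-- Greatest / least fixpoints are given by the Knaster–Tarski
-- formulas (union of post-fixpoints / intersection of pre-fixpoints),
-- quantifying over tuples of subsets of X at the valuation's level ℓ.

module Semantics {T : SetFunctor} (Σ' : Signature T) (C : Coalg T) where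
  open Signature Σ'
  open Coalg C

  ⟦_⟧ : ∀ {ℓ} {Δ : Set} → Form Λ₀ Λ₁ Δ → (Δ → Pred Carrier ℓ) →
        Pred Carrier (suc ℓ)
  ⟦_⟧ {ℓ} tt V x = Lift (suc ℓ) ⊤
  ⟦_⟧ {ℓ} ff V x = Lift (suc ℓ) ⊥
  ⟦ φ ∧' ψ ⟧ V x = ⟦ φ ⟧ V x × ⟦ ψ ⟧ V x
  ⟦ φ ∨' ψ ⟧ V x = ⟦ φ ⟧ V x ⊎ ⟦ ψ ⟧ V x
  ⟦_⟧ {ℓ} (prop p) V x = Lift (suc ℓ) (atom p (str x))
  ⟦ mod h φ ⟧ V x = lift h (⟦ φ ⟧ V) (str x)
  ⟦_⟧ {ℓ} (var y) V x = Lift (suc ℓ) (V y x)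
  ⟦ fix ν n ys _ φs ⟧ V x =
    ∃ λ (As : Fin (sucℕ n) → Pred Carrier _) →
      (∀ i → As i ⊆ ⟦ φs i ⟧ (update V ys As)) × As fzero x
  ⟦ fix μ n ys _ φs ⟧ V x =
    ∀ (As : Fin (sucℕ n) → Pred Carrier _) →
      (∀ i → ⟦ φs i ⟧ (update V ys As) ⊆ As i) → As fzero x

module Submission where

-- Boolean, atomic and variable cases are immediate; the
-- modal case is the simulation condition followed by monotonicity of the
-- predicate lifting.  For the fixpoint cases two general facts come first:
--   * the semantics is monotone in the valuation (⟦⟧-mono);
--   * images commute with valuation update: if S[Aᵢ] ⊆ Bᵢ for all i then
--     S[V[ȳ ↦ Ā]] ⊆ S[V][ȳ ↦ B̄] pointwise (image-update).
-- Together with the induction hypothesis they give a transfer principle for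
-- the bodies φᵢ.  For ν, the image of a post-fixpoint Ā of C is a
-- post-fixpoint S[Ā] of D.  For μ, a pre-fixpoint B̄ of D is pulled back to
-- the pre-fixpoint S⁻[B̄] of C, where S⁻[B] = {x | ∀y. xSy → y ∈ B} is the
-- universal preimage, which satisfies S[S⁻[B]] ⊆ B.

open import Defs
open import Level using (Level) renaming (lift to lift↑)
open import Relation.Unary using (Pred; _⊆_)
open import Relation.Binary using (REL)
open import Data.Product using (_,_)
open import Data.Sum using (inj₁; inj₂)
open import Data.Fin using (Fin)
open import Data.Nat using (ℕ) renaming (suc to sucℕ)

_⊆ᵥ_ : ∀ {ℓ} {Δ X : Set} → (Δ → Pred X ℓ) → (Δ → Pred X ℓ) → Set ℓ
V ⊆ᵥ W = ∀ z → V z ⊆ W z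

update-mono : ∀ {ℓ} {Δ X : Set} {n : ℕ} {V W : Δ → Pred X ℓ} →
  V ⊆ᵥ W → (ys : Fin (sucℕ n) → Δ) (As : Fin (sucℕ n) → Pred X ℓ) →
  update V ys As ⊆ᵥ update W ys As
update-mono V⊆W ys As z (inj₁ updated)        = inj₁ updated
update-mono V⊆W ys As z (inj₂ (fresh , inV)) = inj₂ (fresh , V⊆W z inV)

image-update : ∀ {ℓ} {Δ X Y : Set} {n : ℕ} (S : REL X Y ℓ)
  (V : Δ → Pred X ℓ) (ys : Fin (sucℕ n) → Δ)
  {As : Fin (sucℕ n) → Pred X ℓ} {Bs : Fin (sucℕ n) → Pred Y ℓ} →
  (∀ i → image S (As i) ⊆ Bs i) →
  imageVal S (update V ys As) ⊆ᵥ update (imageVal S V) ys Bs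
image-update S V ys As⊆Bs z (x , inj₁ (i , z≡yᵢ , inA) , xSy) =
  inj₁ (i , z≡yᵢ , As⊆Bs i (x , inA , xSy))
image-update S V ys As⊆Bs z (x , inj₂ (fresh , inV) , xSy) =
  inj₂ (fresh , (x , inV , xSy))

preimage : ∀ {ℓ} {X Y : Set} → REL X Y ℓ → Pred Y ℓ → Pred X ℓ
preimage S B x = ∀ y → S x y → B y

image-preimage : ∀ {ℓ} {X Y : Set} (S : REL X Y ℓ) (B : Pred Y ℓ) →
  image S (preimage S B) ⊆ B
image-preimage S B (x , allInB , xSy) = allInB _ xSy

module Monotonicity {T : SetFunctor} (Σ' : Signature T) (C : Coalg T) where
  open Signature Σ'
  open Coalg C
  open Semantics Σ' C

  ⟦⟧-mono : ∀ {ℓ} {Δ : Set} (φ : Form Λ₀ Λ₁ Δ) {V W : Δ → Pred Carrier ℓ} →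
    V ⊆ᵥ W → ⟦ φ ⟧ V ⊆ ⟦ φ ⟧ W
  ⟦⟧-mono tt        V⊆W holds          = holds
  ⟦⟧-mono ff        V⊆W holds          = holds
  ⟦⟧-mono (φ ∧' ψ)  V⊆W (inφ , inψ)    = ⟦⟧-mono φ V⊆W inφ , ⟦⟧-mono ψ V⊆W inψ
  ⟦⟧-mono (φ ∨' ψ)  V⊆W (inj₁ inφ)     = inj₁ (⟦⟧-mono φ V⊆W inφ)
  ⟦⟧-mono (φ ∨' ψ)  V⊆W (inj₂ inψ)     = inj₂ (⟦⟧-mono ψ V⊆W inψ)
  ⟦⟧-mono (prop p)  V⊆W holds          = holds
  ⟦⟧-mono (mod h φ) V⊆W holds          = lift-mono h (⟦⟧-mono φ V⊆W) holds
  ⟦⟧-mono (var z)   V⊆W (lift↑ inV)    = lift↑ (V⊆W z inV)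
  ⟦⟧-mono (fix ν n ys _ φs) V⊆W (As , post , inA₀) =
    As , (λ i inAᵢ → ⟦⟧-mono (φs i) (update-mono V⊆W ys As) (post i inAᵢ)) , inA₀
  ⟦⟧-mono (fix μ n ys _ φs) V⊆W inLfp Bs pre =
    inLfp Bs (λ i inφᵢ → pre i (⟦⟧-mono (φs i) (update-mono V⊆W ys Bs) inφᵢ))

module Preservation {T : SetFunctor} (Σ' : Signature T) (C D : Coalg T)
    {ℓ : Level} (S : REL (Coalg.Carrier C) (Coalg.Carrier D) ℓ)
    (sim : IsSimulation Σ' C D S) where
  open Signature Σ'
  open IsSimulation sim
  open Monotonicity Σ' D using (⟦⟧-mono)
  module SC = Semantics Σ' C
  module SD = Semantics Σ' D

  X Y : Set
  X = Coalg.Carrier C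
  Y = Coalg.Carrier D

  preserve : ∀ {Δ : Set} (V : Δ → Pred X ℓ) (φ : Form Λ₀ Λ₁ Δ) →
    image S (SC.⟦ φ ⟧ V) ⊆ SD.⟦ φ ⟧ (imageVal S V)

  transfer : ∀ {Δ : Set} {n : ℕ} (V : Δ → Pred X ℓ) (ys : Fin (sucℕ n) → Δ)
    {As : Fin (sucℕ n) → Pred X ℓ} {Bs : Fin (sucℕ n) → Pred Y ℓ} →
    (∀ i → image S (As i) ⊆ Bs i) → (φ : Form Λ₀ Λ₁ Δ) →
    image S (SC.⟦ φ ⟧ (update V ys As)) ⊆ SD.⟦ φ ⟧ (update (imageVal S V) ys Bs)
  transfer V ys As⊆Bs φ inImage =
    ⟦⟧-mono φ (image-update S V ys As⊆Bs) (preserve (update V ys _) φ inImage)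

  preserve V tt       (x , holds , xSy)        = holds
  preserve V ff       (x , lift↑ () , xSy)
  preserve V (φ ∧' ψ) (x , (inφ , inψ) , xSy)  =
    preserve V φ (x , inφ , xSy) , preserve V ψ (x , inψ , xSy)
  preserve V (φ ∨' ψ) (x , inj₁ inφ , xSy)     = inj₁ (preserve V φ (x , inφ , xSy))
  preserve V (φ ∨' ψ) (x , inj₂ inψ , xSy)     = inj₂ (preserve V ψ (x , inψ , xSy))
  preserve V (prop p) (x , lift↑ holds , xSy)  = lift↑ (sim-atom p xSy holds)
  preserve V (mod h φ) (x , holds , xSy)       =
    lift-mono h (preserve V φ) (sim-lift h (SC.⟦ φ ⟧ V) xSy holds)
  preserve V (var z)  (x , lift↑ inV , xSy)    = lift↑ (x , inV , xSy)
  -- ν: the image S[Ā] of a post-fixpoint Ā in C is a post-fixpoint in D.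
  preserve V (fix ν n ys _ φs) (x , (As , post , inA₀) , xSy) =
    (λ i → image S (As i)) ,
    (λ { i (x' , inAᵢ , x'Sy') →
           transfer V ys (λ j inImage → inImage) (φs i) (x' , post i inAᵢ , x'Sy') }) ,
    (x , inA₀ , xSy)
  -- μ: a pre-fixpoint B̄ in D pulls back to the pre-fixpoint S⁻[B̄] in C.
  preserve V (fix μ n ys _ φs) (x , inLfp , xSy) Bs pre =
    inLfp As As-pre _ xSy
    where
    As : Fin (sucℕ n) → Pred X ℓ
    As i = preimage S (Bs i)

    As-pre : ∀ i → SC.⟦ φs i ⟧ (update V ys As) ⊆ As i
    As-pre i inφᵢ y' x'Sy' =
      pre i (transfer V ys (λ j → image-preimage S (Bs j)) (φs i) (_ , inφᵢ , x'Sy'))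

lemma6p1 : (T : SetFunctor) → NonTrivial T → PreservesSubsets T →
    (Σ' : Signature T) (C D : Coalg T) {ℓ : Level}
    (S : REL (Coalg.Carrier C) (Coalg.Carrier D) ℓ) →
    IsSimulation Σ' C D S →
    {Δ : Set} (V : Δ → Coalg.Carrier C → Set ℓ)
    (φ : Form (Signature.Λ₀ Σ') (Signature.Λ₁ Σ') Δ) →
    image S (Semantics.⟦_⟧ Σ' C φ V) ⊆ Semantics.⟦_⟧ Σ' D φ (imageVal S V)
lemma6p1 T _ _ Σ' C D S sim = Preservation.preserve Σ' C D S sim
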